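{- Let $\Gamma$ be a simple connected cubic girth-regular graph of girth $g$ and order $n$ with signature $(2,2,2)$. Then $g$ divides $3n$ and $\Gamma$ is the skeleton of a $\{g,3\}$-map embedded on a surface with Euler characteristic $\chi=n\left(\frac{3}{g}-\frac12\right)$. Moreover, every automorphism of $\Gamma$ extends to an automorphism of this map; in particular, if $\Gamma$ is vertex-transitive, so is the map.
   Context: Cubic means $3$-regular. For a graph of finite girth $g$, a girth cycle is a cycle of length $g$, and $\epsilon(e)$ is the number of girth cycles containing the edge $e$. The signature of a vertex $v$ with incident edges $e_1,\ldots,e_k$ ordered so that $\epsilon(e_1)\le\cdots\le\epsilon(e_k)$ is $(\epsilon(e_1),\ldots,\epsilon(e_k))$; a graph is girth-regular if all vertices have the same signature (the signature of the graph). A map: view a connected graph $\Lambda$ as a $1$-dimensional CW complex and, for a set $\mathcal{T}$ of simple closed walks (closed walks using each edge at most once), attach one disk per walk along the closed curve of the walk (injectively except over vertices); if the result is a closed surface it is a map with skeleton $\Lambda$, faces the $2$-cells and face cycles the walks of $\mathcal{T}$. A $\{m,k\}$-map is one whose skeleton is $k$-regular and all of whose face cycles have length $m$. An automorphism of a map is a permutation of flags induced by a homeomorphism of the surface preserving the embedded graph; a map is vertex-transitive if its automorphism group induces a vertex-transitive group on its skeleton. -}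

module Defs where

open import Data.Nat as ℕ using (ℕ; zero; suc; _≤_; _<_; _<ᵇ_)
open import Data.Nat.DivMod using (_mod_)
open import Data.Integer as ℤ using (ℤ; +_)
open import Data.Bool using (Bool; true; false; _∧_; _∨_)
open import Data.Fin as Fin using (Fin; toℕ)
open import Data.Fin.Subset using (∣_∣)
open import Data.Vec using (tabulate)
open import Data.List as List using (List; length; allFin)
open import Data.Nat.ListAction using (sum)
open import Data.List.Relation.Unary.Linked using (Linked)
open import Data.Product using (Σ; ∃; _×_)
open import Data.Sum using (_⊎_)
open import Function using (_∘_)
open import Function.Bundles using (_↔_; Inverse)
open import Relation.Nullary using (¬_)
open import Relation.Nullary.Decidable using (⌊_⌋)
open import Relation.Binary.PropositionalEquality using (_≡_; _≢_)
open import Relation.Binary.Construct.Closure.ReflexiveTransitive using (Star)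

record Graph (n : ℕ) : Set where
  field
    adj    : Fin n → Fin n → Bool
    sym    : ∀ u v → adj u v ≡ adj v u
    irrefl : ∀ v → adj v v ≡ false

module _ {n : ℕ} (Γ : Graph n) where
  open Graph Γ

  Adj : Fin n → Fin n → Set
  Adj u v = adj u v ≡ true

  degree : Fin n → ℕ
  degree v = ∣ tabulate (adj v) ∣

  Cubic : Set
  Cubic = ∀ v → degree v ≡ 3

  Connected : Set
  Connected = ∀ u v → Star Adj u v

  edgeCount : ℕ
  edgeCount = sum (List.map (λ u → ∣ tabulate (λ v → adj u v ∧ (toℕ u <ᵇ toℕ v)) ∣) (allFin n))

cnext : ∀ {l} → Fin l → Fin l
cnext {zero} ()
cnext {suc l} i = suc (toℕ i) mod suc l

EdgeOf : ∀ {n l} → (Fin l → Fin n) → Fin n → Fin n → Set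
EdgeOf w u v = ∃ λ i → (w i ≡ u × w (cnext i) ≡ v) ⊎ (w i ≡ v × w (cnext i) ≡ u)

module _ {n : ℕ} (Γ : Graph n) where

  IsCycle : (k : ℕ) → (Fin k → Fin n) → Set
  IsCycle k c = 3 ≤ k × (∀ i j → c i ≡ c j → i ≡ j) × (∀ i → Adj Γ (c i) (c (cnext i)))

  HasGirth : ℕ → Set
  HasGirth g = (Σ (Fin g → Fin n) (IsCycle g)) × (∀ k c → IsCycle k c → g ≤ k)

  -- two cycles of length g are the same subgraph (same edge set)
  SameCycle : ∀ {g} → (Fin g → Fin n) → (Fin g → Fin n) → Set
  SameCycle c c' = ∀ x y → (EdgeOf c x y → EdgeOf c' x y) × (EdgeOf c' x y → EdgeOf c x y)

  -- ε(uv) = k, for g the girth: there are exactly k girth cycles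
  -- (as subgraphs) containing the edge uv
  Eps : (g : ℕ) → Fin n → Fin n → ℕ → Set
  Eps g u v k =
    Σ (Fin k → Fin g → Fin n) λ cs →
      (∀ j → IsCycle g (cs j) × EdgeOf (cs j) u v) ×
      (∀ j j' → SameCycle (cs j) (cs j') → j ≡ j') ×
      (∀ c → IsCycle g c → EdgeOf c u v → ∃ λ j → SameCycle c (cs j))

  -- vertex v has signature s: the incident edges v nb₀, …, v nb_{k-1}
  -- (each exactly once) have ε-values s₀ ≤ … ≤ s_{k-1}
  HasSignature : (g : ℕ) → Fin n → List ℕ → Set
  HasSignature g v s =
    Σ (Fin (length s) → Fin n) λ nb →
      (∀ i j → nb i ≡ nb j → i ≡ j) ×
      (∀ i → Adj Γ v (nb i)) ×
      (∀ u → Adj Γ v u → ∃ λ i → nb i ≡ u) ×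
      (∀ i → Eps g v (nb i) (List.lookup s i)) ×
      Linked _≤_ s

  GirthRegularWithSignature : ℕ → List ℕ → Set
  GirthRegularWithSignature g s = ∀ v → HasSignature g v s

  IsGraphAut : (Fin n ↔ Fin n) → Set
  IsGraphAut σ = ∀ u v → Graph.adj Γ (Inverse.to σ u) (Inverse.to σ v) ≡ Graph.adj Γ u v

  VertexTransitive : Set
  VertexTransitive = ∀ u v → Σ (Fin n ↔ Fin n) λ σ → IsGraphAut σ × Inverse.to σ u ≡ v

-- A candidate map with skeleton Γ: F faces; face f has face cycle
-- walk f : Fin (len f) → Fin n, the closed walk
-- walk f 0, walk f 1, …, walk f (len f - 1), walk f 0.
record Map {n : ℕ} (Γ : Graph n) : Set where
  field
    F    : ℕ
    len  : Fin F → ℕ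
    walk : (f : Fin F) → Fin (len f) → Fin n

module _ {n : ℕ} {Γ : Graph n} (M : Map Γ) where
  open Map M

  stepIs : (f : Fin F) → Fin (len f) → Fin n → Fin n → Bool
  stepIs f i u v =
    (⌊ walk f i Fin.≟ u ⌋ ∧ ⌊ walk f (cnext i) Fin.≟ v ⌋) ∨
    (⌊ walk f i Fin.≟ v ⌋ ∧ ⌊ walk f (cnext i) Fin.≟ u ⌋)

  sidesOf : Fin n → Fin n → ℕ
  sidesOf u v = sum (List.map (λ f → ∣ tabulate (λ i → stepIs f i u v) ∣) (allFin F))

  Corner : Fin n → Fin n → Fin n → Set
  Corner v a b = ∃ λ f → ∃ λ (i : Fin (len f)) →
    walk f i ≡ a × walk f (cnext i) ≡ v × walk f (cnext (cnext i)) ≡ b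

  LinkAdj : Fin n → Fin n → Fin n → Set
  LinkAdj v a b = Corner v a b ⊎ Corner v b a

  -- the face cycles are simple closed walks of Γ and attaching the
  -- faces yields a closed surface: every edge lies on exactly two
  -- face-sides and the link of every vertex is connected (hence,
  -- being 2-regular, a single circle)
  IsMap : Set
  IsMap =
    (∀ f → 0 < len f) ×
    (∀ f i → Adj Γ (walk f i) (walk f (cnext i))) ×
    (∀ f i j → i ≢ j → ¬ (stepIs f j (walk f i) (walk f (cnext i)) ≡ true)) ×
    (∀ u v → Adj Γ u v → sidesOf u v ≡ 2) ×
    (∀ v a b → Adj Γ v a → Adj Γ v b → Star (LinkAdj v) a b)

  IsMKMap : ℕ → ℕ → Set
  IsMKMap m k = IsMap × (∀ v → degree Γ v ≡ k) × (∀ f → len f ≡ m)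

  eulerChar : ℤ
  eulerChar = (+ n ℤ.- + edgeCount Γ) ℤ.+ + F

  -- two closed walks are the same face cycle: equal up to rotation
  -- and reversal of the cyclic sequence
  SameClosedWalk : ∀ {l l'} → (Fin l → Fin n) → (Fin l' → Fin n) → Set
  SameClosedWalk {l} {l'} w w' =
    Σ (Fin l ↔ Fin l') λ h →
      (∀ i → w' (Inverse.to h i) ≡ w i) ×
      ((∀ i → Inverse.to h (cnext i) ≡ cnext (Inverse.to h i)) ⊎
       (∀ i → cnext (Inverse.to h (cnext i)) ≡ Inverse.to h i))

  ExtendsToMapAut : (Fin n ↔ Fin n) → Set
  ExtendsToMapAut σ =
    IsGraphAut Γ σ ×
    Σ (Fin F ↔ Fin F) λ π →
      ∀ f → SameClosedWalk (Inverse.to σ ∘ walk f) (walk (Inverse.to π f))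

  MapVertexTransitive : Set
  MapVertexTransitive = ∀ u v → Σ (Fin n ↔ Fin n) λ σ → ExtendsToMapAut σ × Inverse.to σ u ≡ v

-- Since every edge lies on exactly two girth cycles, a girth cycle through a vertex v uses two
-- of the three edges at v, and it is determined by the edge it misses: if two girth cycles both
-- miss d at v, take a girth cycle D through d; D also uses one of the other two edges e, and
-- then the two cycles and D are three girth cycles through e, so two of them agree, which can
-- only be the first two.  Conversely, for each edge d at v some girth cycle misses d.  Taking
-- the girth cycles as faces, every edge lies on exactly two faces and any two edges at a vertex
-- are consecutive on a face, so the faces form a map.  Its flags (face, position) correspond
-- bijectively to the corners (vertex, missed edge), whence F g = 3 n; with 2 E = 3 n this gives
-- 2 g χ = 6 n - g n.  Graph automorphisms permute girth cycles, hence faces.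
module Submission where

open import Defs
open import Level using (0ℓ)
open import Data.Bool using (Bool; true; false; _∧_; _∨_; if_then_else_)
open import Data.Fin as Fin using (Fin; zero; suc; toℕ; fromℕ; inject₁; punchIn; punchOut; _≟_)
open import Data.Fin.Induction using (<-weakInduction)
open import Data.Fin.Properties
  using (toℕ-injective; toℕ-fromℕ<; toℕ-inject₁; toℕ<n; toℕ-fromℕ; punchInᵢ≢i;
         punchIn-punchOut; punchIn-injective; *↔×; cantor-schröder-bernstein; any?; all?)
open import Data.Fin.Relation.Unary.Top using (view; ‵fromℕ; ‵inject₁)
open import Data.Fin.Subset using (∣_∣)
open import Data.Integer as ℤ using (+_)
open import Data.Integer.Properties using (pos-+; pos-*)
open import Data.Integer.Tactic.RingSolver using (solve-∀)
open import Data.List as List using (_∷_; []; allFin)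
open import Data.List.Properties using (map-tabulate)
open import Data.Nat as ℕ using (ℕ; zero; suc; _+_; _*_; _<ᵇ_; s≤s; z≤n)
open import Data.Nat.Divisibility using (_∣_; divides)
open import Data.Nat.DivMod using (m<n⇒m%n≡m; n%n≡0)
open import Data.Nat.ListAction using (sum)
open import Data.Nat.Properties
  using (+-0-commutativeMonoid; +-identityʳ; *-zeroʳ; *-comm; m≢1+n+m; m≤n⇒∃[o]m+o≡n)
open import Algebra.Properties.CommutativeMonoid.Sum +-0-commutativeMonoid as ∑
  using (sum-syntax; sum-cong-≗; sum-remove; ∑-comm; ∑-distrib-+)
open import Data.Product using (Σ; ∃; ∃₂; _×_; _,_; proj₁; proj₂; swap; uncurry)
open import Data.Sum using (_⊎_; inj₁; inj₂)
open import Data.Vec using (tabulate)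
open import Function using (_∘_; _∘₂_; id)
open import Function.Bundles using (_↔_; _↣_; Inverse; Injection; mk↔ₛ′; mk↣)
open import Function.Construct.Composition using (_↣-∘_)
open import Function.Construct.Symmetry using (↔-sym)
open import Function.Definitions using (Injective)
open import Function.Properties.Inverse using (↔⇒↣)
open import Relation.Binary.Bundles using (DecSetoid)
open import Relation.Binary.Construct.Closure.ReflexiveTransitive using (Star; ε; _◅_)
open import Relation.Binary.Definitions using (Decidable)
open import Relation.Binary.PropositionalEquality
open import Relation.Binary.Structures using (IsEquivalence)
open import Relation.Nullary using (¬_; contradiction; Dec; yes; no; does)
open import Relation.Nullary.Decidable
  using (from-yes; dec-true; dec-false; isYes≗does; decidable-stable; ¬?; _×-dec_; _⊎-dec_; _→-dec_)

𝟙 : Bool → ℕ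
𝟙 b = if b then 1 else 0

∣tabulate∣≡∑𝟙 : ∀ {N} (p : Fin N → Bool) → ∣ tabulate p ∣ ≡ ∑[ i < N ] 𝟙 (p i)
∣tabulate∣≡∑𝟙 {zero}  p = refl
∣tabulate∣≡∑𝟙 {suc N} p with p zero
... | true  = cong suc (∣tabulate∣≡∑𝟙 (p ∘ suc))
... | false = ∣tabulate∣≡∑𝟙 (p ∘ suc)

sum-tabulate : ∀ {N} (h : Fin N → ℕ) → sum (List.tabulate h) ≡ ∑[ i < N ] h i
sum-tabulate {zero}  h = refl
sum-tabulate {suc N} h = cong (h zero ℕ.+_) (sum-tabulate (h ∘ suc))

sum-map-allFin : ∀ {N} (h : Fin N → ℕ) → sum (List.map h (allFin N)) ≡ ∑[ i < N ] h i
sum-map-allFin h = trans (cong sum (map-tabulate id h)) (sum-tabulate h)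

∑-const : ∀ {N} {h : Fin N → ℕ} c → (∀ i → h i ≡ c) → ∑[ i < N ] h i ≡ N * c
∑-const {zero}  c h≡c = refl
∑-const {suc N} c h≡c = cong₂ _+_ (h≡c zero) (∑-const c (h≡c ∘ suc))

∑-zero : ∀ {N} {h : Fin N → ℕ} → (∀ i → h i ≡ 0) → ∑[ i < N ] h i ≡ 0
∑-zero {N} h≡0 = trans (∑-const 0 h≡0) (*-zeroʳ N)

∑-support₁ : ∀ {N} (h : Fin N → ℕ) a → (∀ i → i ≢ a → h i ≡ 0) → ∑[ i < N ] h i ≡ h a
∑-support₁ {suc N} h a h≡0 = begin
  ∑.sum h                      ≡⟨ sum-remove h ⟩
  h a + ∑.sum (h ∘ punchIn a)  ≡⟨ cong (h a ℕ.+_) (∑-zero (λ i → h≡0 _ (punchInᵢ≢i a i))) ⟩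
  h a + 0                      ≡⟨ +-identityʳ (h a) ⟩
  h a                          ∎
  where open ≡-Reasoning

∑-support₂ : ∀ {N} (h : Fin N → ℕ) {a b} → a ≢ b → (∀ i → i ≢ a → i ≢ b → h i ≡ 0) →
             ∑[ i < N ] h i ≡ h a + h b
∑-support₂ {suc N} h {a} {b} a≢b h≡0 = begin
  ∑.sum h                      ≡⟨ sum-remove h ⟩
  h a + ∑.sum (h ∘ punchIn a)  ≡⟨ cong (h a ℕ.+_) (∑-support₁ (h ∘ punchIn a) b′ h∘punchIn≡0) ⟩
  h a + h (punchIn a b′)       ≡⟨ cong (λ i → h a + h i) (punchIn-punchOut a≢b) ⟩
  h a + h b                    ∎
  where
  open ≡-Reasoning
  b′ : Fin N
  b′ = punchOut a≢b
  h∘punchIn≡0 : ∀ i → i ≢ b′ → h (punchIn a i) ≡ 0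
  h∘punchIn≡0 i i≢b′ = h≡0 _ (punchInᵢ≢i a i)
    (λ eq → i≢b′ (punchIn-injective a i b′ (trans eq (sym (punchIn-punchOut a≢b)))))

cantor-schröder-bernstein-× : ∀ {a b c d} →
  (Fin a × Fin b) ↣ (Fin c × Fin d) → (Fin c × Fin d) ↣ (Fin a × Fin b) → a * b ≡ c * d
cantor-schröder-bernstein-× φ ψ =
  cantor-schröder-bernstein (Injection.injective (through φ)) (Injection.injective (through ψ))
  where
  through : ∀ {a b c d} → (Fin a × Fin b) ↣ (Fin c × Fin d) → Fin (a * b) ↣ Fin (c * d)
  through φ = ↔⇒↣ (↔-sym *↔×) ↣-∘ (φ ↣-∘ ↔⇒↣ *↔×)

-- Transversals of a decidable equivalence

module _ {c ℓ} (S : DecSetoid c ℓ) where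
  open DecSetoid S using (Carrier; _≈_) renaming (_≟_ to _≈?_; refl to ≈-refl; sym to ≈-sym)

  record Transversal {N} (x : Fin N → Carrier) : Set ℓ where
    field
      size      : ℕ
      rep       : Fin size → Fin N
      rep-apart : ∀ {f f'} → x (rep f) ≈ x (rep f') → f ≡ f'
      rep-cover : ∀ i → ∃ λ f → x (rep f) ≈ x i

  transversal : ∀ {N} (x : Fin N → Carrier) → Transversal x
  transversal {zero} x = record { size = 0 ; rep = λ () ; rep-apart = λ { {()} } ; rep-cover = λ () }
  transversal {suc N} x with transversal (x ∘ suc)
  ... | record { size = F ; rep = r ; rep-apart = apart ; rep-cover = cover }
    with any? (λ f → x (suc (r f)) ≈? x zero)
  ... | yes (f₀ , x₀≈) = record
    { size = F
    ; rep = suc ∘ r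
    ; rep-apart = apart
    ; rep-cover = λ { zero → f₀ , x₀≈ ; (suc i) → cover i }
    }
  ... | no x₀≉ = record
    { size = suc F
    ; rep = λ { zero → zero ; (suc f) → suc (r f) }
    ; rep-apart = λ { {zero} {zero} _ → refl
                    ; {zero} {suc f} x₀≈ → contradiction (f , ≈-sym x₀≈) x₀≉
                    ; {suc f} {zero} ≈x₀ → contradiction (f , ≈x₀) x₀≉
                    ; {suc f} {suc f'} x≈x' → cong suc (apart x≈x') }
    ; rep-cover = λ { zero → zero , ≈-refl ; (suc i) → let f , x≈ = cover i in suc f , x≈ }
    }

cnext-fromℕ : ∀ l → cnext (fromℕ l) ≡ zero
cnext-fromℕ l = toℕ-injective (begin
  toℕ (cnext (fromℕ l))      ≡⟨ toℕ-fromℕ< _ ⟩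
  suc (toℕ (fromℕ l)) ℕ.% suc l ≡⟨ cong (λ k → suc k ℕ.% suc l) (toℕ-fromℕ l) ⟩
  suc l ℕ.% suc l             ≡⟨ n%n≡0 (suc l) ⟩
  0                           ∎)
  where open ≡-Reasoning

cnext-inject₁ : ∀ {l} (i : Fin l) → cnext (inject₁ i) ≡ suc i
cnext-inject₁ {l} i = toℕ-injective (begin
  toℕ (cnext (inject₁ i))         ≡⟨ toℕ-fromℕ< _ ⟩
  suc (toℕ (inject₁ i)) ℕ.% suc l ≡⟨ cong (λ k → suc k ℕ.% suc l) (toℕ-inject₁ i) ⟩
  suc (toℕ i) ℕ.% suc l           ≡⟨ m<n⇒m%n≡m (ℕ.s≤s (toℕ<n i)) ⟩
  suc (toℕ i)                     ∎)
  where open ≡-Reasoning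

cprev : ∀ {l} → Fin (suc l) → Fin (suc l)
cprev zero    = fromℕ _
cprev (suc i) = inject₁ i

cnext-cprev : ∀ {l} (i : Fin (suc l)) → cnext (cprev i) ≡ i
cnext-cprev zero    = cnext-fromℕ _
cnext-cprev (suc i) = cnext-inject₁ i

cprev-cnext : ∀ {l} (i : Fin (suc l)) → cprev (cnext i) ≡ i
cprev-cnext i with view i
... | ‵fromℕ     = cong cprev (cnext-fromℕ _)
... | ‵inject₁ j = cong cprev (cnext-inject₁ j)

cnext-injective : ∀ {l} → Injective _≡_ _≡_ (cnext {suc l})
cnext-injective {_} {i} {j} eq = trans (sym (cprev-cnext i)) (trans (cong cprev eq) (cprev-cnext j))

cnext²≢id : ∀ {m} (i : Fin (3 + m)) → cnext (cnext i) ≢ i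
cnext²≢id {m} i with view i
... | ‵fromℕ rewrite cnext-fromℕ (2 + m) | cnext-inject₁ (zero {2 + m}) = λ ()
... | ‵inject₁ j with view j
...   | ‵fromℕ rewrite cnext-inject₁ (fromℕ (1 + m)) | cnext-fromℕ (2 + m) = λ ()
...   | ‵inject₁ k rewrite cnext-inject₁ (inject₁ k) | cnext-inject₁ (suc k) =
          λ eq → m≢1+n+m (toℕ k) {1}
                   (sym (trans (cong toℕ eq) (trans (toℕ-inject₁ (inject₁ k)) (toℕ-inject₁ k))))

cnext-induction : ∀ {l p} (P : Fin (suc l) → Set p) → P zero → (∀ i → P i → P (cnext i)) → ∀ i → P i
cnext-induction P P₀ step = <-weakInduction P P₀ (λ i Pi → subst P (cnext-inject₁ i) (step _ Pi))

-- Handshake lemma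

𝟙<ᵇ+𝟙>ᵇ≡1 : ∀ {a b} → a ≢ b → 𝟙 (a <ᵇ b) + 𝟙 (b <ᵇ a) ≡ 1
𝟙<ᵇ+𝟙>ᵇ≡1 {zero}  {zero}  a≢b = contradiction refl a≢b
𝟙<ᵇ+𝟙>ᵇ≡1 {zero}  {suc b} a≢b = refl
𝟙<ᵇ+𝟙>ᵇ≡1 {suc a} {zero}  a≢b = refl
𝟙<ᵇ+𝟙>ᵇ≡1 {suc a} {suc b} a≢b = 𝟙<ᵇ+𝟙>ᵇ≡1 (a≢b ∘ cong suc)

module _ {n} (Γ : Graph n) where
  open Graph Γ using (adj; irrefl)

  private
    𝟙[adj∧<] : Fin n → Fin n → ℕ
    𝟙[adj∧<] u v = 𝟙 (adj u v ∧ (toℕ u <ᵇ toℕ v))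

    𝟙[adj∧<]-sym : ∀ u v → 𝟙[adj∧<] u v + 𝟙[adj∧<] v u ≡ 𝟙 (adj u v)
    𝟙[adj∧<]-sym u v rewrite Graph.sym Γ v u with adj u v in uv
    ... | false = refl
    ... | true  = 𝟙<ᵇ+𝟙>ᵇ≡1 (λ eq → u≢v (toℕ-injective eq))
      where
      u≢v : u ≢ v
      u≢v refl with () ← trans (sym uv) (irrefl u)

    edgeCount≡∑∑ : edgeCount Γ ≡ ∑[ u < n ] ∑[ v < n ] 𝟙[adj∧<] u v
    edgeCount≡∑∑ =
      trans (sum-map-allFin (λ u → ∣ tabulate (λ v → adj u v ∧ (toℕ u <ᵇ toℕ v)) ∣))
            (sum-cong-≗ {n} (λ u → ∣tabulate∣≡∑𝟙 (λ v → adj u v ∧ (toℕ u <ᵇ toℕ v))))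

  handshake : edgeCount Γ + edgeCount Γ ≡ ∑[ u < n ] degree Γ u
  handshake = begin
    edgeCount Γ + edgeCount Γ
      ≡⟨ cong₂ _+_ edgeCount≡∑∑ (trans edgeCount≡∑∑ (∑-comm 𝟙[adj∧<])) ⟩
    ∑[ u < n ] ∑[ v < n ] 𝟙[adj∧<] u v + ∑[ u < n ] ∑[ v < n ] 𝟙[adj∧<] v u
      ≡⟨ sym (∑-distrib-+ (λ u → ∑[ v < n ] 𝟙[adj∧<] u v) (λ u → ∑[ v < n ] 𝟙[adj∧<] v u)) ⟩
    ∑[ u < n ] (∑[ v < n ] 𝟙[adj∧<] u v + ∑[ v < n ] 𝟙[adj∧<] v u)
      ≡⟨ sum-cong-≗ {n} (λ u → sym (∑-distrib-+ (𝟙[adj∧<] u) (λ v → 𝟙[adj∧<] v u))) ⟩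
    ∑[ u < n ] ∑[ v < n ] (𝟙[adj∧<] u v + 𝟙[adj∧<] v u)
      ≡⟨ sum-cong-≗ {n} (λ u → trans (sum-cong-≗ {n} (𝟙[adj∧<]-sym u))
                                      (sym (∣tabulate∣≡∑𝟙 (adj u)))) ⟩
    ∑[ u < n ] degree Γ u
      ∎
    where open ≡-Reasoning

-- EdgeOf w u v unfolds to ∃ λ i → Traverses w i u v, and Corner M v a b to
-- ∃ λ f → PassesThrough (walk M f) a v b.
Traverses : ∀ {n l} → (Fin l → Fin n) → Fin l → Fin n → Fin n → Set
Traverses w i u v = (w i ≡ u × w (cnext i) ≡ v) ⊎ (w i ≡ v × w (cnext i) ≡ u)

PassesThrough : ∀ {n l} → (Fin l → Fin n) → Fin n → Fin n → Fin n → Set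
PassesThrough w a v b = ∃ λ i → w i ≡ a × w (cnext i) ≡ v × w (cnext (cnext i)) ≡ b

edgeOf-position : ∀ {n l} {w : Fin l → Fin n} {u v} → EdgeOf w u v → ∃ λ j → w j ≡ u
edgeOf-position (i , inj₁ (wi , _))  = i , wi
edgeOf-position (i , inj₂ (_ , wi⁺)) = cnext i , wi⁺

cycle-injective : ∀ {n k} (Γ : Graph n) {c : Fin k → Fin n} → IsCycle Γ k c →
                  ∀ {i j} → c i ≡ c j → i ≡ j
cycle-injective Γ (_ , c-injective , _) = c-injective _ _

module _ {n : ℕ} (Γ : Graph n) {m : ℕ} {c : Fin (3 + m) → Fin n} (c-cycle : IsCycle Γ (3 + m) c) where

  private
    c-injective : ∀ {i j} → c i ≡ c j → i ≡ j
    c-injective = cycle-injective Γ c-cycle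

  traverses-unique : ∀ {i j u v} → Traverses c i u v → Traverses c j u v → i ≡ j
  traverses-unique (inj₁ (ci , _))   (inj₁ (cj , _))   = c-injective (trans ci (sym cj))
  traverses-unique (inj₂ (ci , _))   (inj₂ (cj , _))   = c-injective (trans ci (sym cj))
  traverses-unique {i} {j} (inj₁ (ci , ci⁺)) (inj₂ (cj , cj⁺)) =
    contradiction (trans (cong cnext (c-injective (trans cj⁺ (sym ci)))) (c-injective (trans ci⁺ (sym cj))))
                  (cnext²≢id j)
  traverses-unique {i} {j} (inj₂ (ci , ci⁺)) (inj₁ (cj , cj⁺)) =
    contradiction (trans (cong cnext (c-injective (trans ci⁺ (sym cj)))) (c-injective (trans cj⁺ (sym ci))))
                  (cnext²≢id i)

  edgeOf-neighbour : ∀ {j x} → EdgeOf c (c j) x → x ≡ c (cnext j) ⊎ x ≡ c (cprev j)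
  edgeOf-neighbour (i , inj₁ (ci , ci⁺)) = inj₁ (trans (sym ci⁺) (cong (c ∘ cnext) (c-injective ci)))
  edgeOf-neighbour (i , inj₂ (ci , ci⁺)) =
    inj₂ (trans (sym ci) (cong c (trans (sym (cprev-cnext i)) (cong cprev (c-injective ci⁺)))))

  neighbours-distinct : ∀ j → c (cnext j) ≢ c (cprev j)
  neighbours-distinct j eq = cnext²≢id (cprev j)
    (trans (cong cnext (cnext-cprev j)) (c-injective eq))

  edgeOf-consecutive : ∀ {i j} → EdgeOf c (c i) (c j) → j ≡ cnext i ⊎ cnext j ≡ i
  edgeOf-consecutive {i} e with edgeOf-neighbour e
  ... | inj₁ cj≡ = inj₁ (c-injective cj≡)
  ... | inj₂ cj≡ = inj₂ (trans (cong cnext (c-injective cj≡)) (cnext-cprev i))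

  passesThrough-at : ∀ j → PassesThrough c (c (cprev j)) (c j) (c (cnext j))
  passesThrough-at j = cprev j , refl , cong c (cnext-cprev j) , cong (c ∘ cnext) (cnext-cprev j)

  edgeOf-passesThrough : ∀ {v a b} → a ≢ b → EdgeOf c v a → EdgeOf c v b →
                         PassesThrough c a v b ⊎ PassesThrough c b v a
  edgeOf-passesThrough a≢b ea eb with edgeOf-position ea
  ... | j , refl with edgeOf-neighbour ea | edgeOf-neighbour eb
  ...   | inj₁ a≡ | inj₁ b≡ = contradiction (trans a≡ (sym b≡)) a≢b
  ...   | inj₂ a≡ | inj₂ b≡ = contradiction (trans a≡ (sym b≡)) a≢b
  ...   | inj₁ a≡ | inj₂ b≡ = inj₂ (subst₂ (λ x y → PassesThrough c x (c j) y) (sym b≡) (sym a≡) (passesThrough-at j))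
  ...   | inj₂ a≡ | inj₁ b≡ = inj₁ (subst₂ (λ x y → PassesThrough c x (c j) y) (sym a≡) (sym b≡) (passesThrough-at j))

edgeOf-map : ∀ {n n' l} {w : Fin l → Fin n} {u v} (φ : Fin n → Fin n') →
             EdgeOf w u v → EdgeOf (φ ∘ w) (φ u) (φ v)
edgeOf-map φ (i , inj₁ (wi , wi⁺)) = i , inj₁ (cong φ wi , cong φ wi⁺)
edgeOf-map φ (i , inj₂ (wi , wi⁺)) = i , inj₂ (cong φ wi , cong φ wi⁺)

edgeOf-≗ : ∀ {n l} {w w' : Fin l → Fin n} {u v} → w ≗ w' → EdgeOf w u v → EdgeOf w' u v
edgeOf-≗ w≗w' (i , inj₁ (wi , wi⁺)) = i , inj₁ (trans (sym (w≗w' _)) wi , trans (sym (w≗w' _)) wi⁺)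
edgeOf-≗ w≗w' (i , inj₂ (wi , wi⁺)) = i , inj₂ (trans (sym (w≗w' _)) wi , trans (sym (w≗w' _)) wi⁺)

traverses? : ∀ {n l} (w : Fin l → Fin n) i u v → Dec (Traverses w i u v)
traverses? w i u v = (w i ≟ u ×-dec w (cnext i) ≟ v) ⊎-dec (w i ≟ v ×-dec w (cnext i) ≟ u)

edgeOf? : ∀ {n l} (w : Fin l → Fin n) u v → Dec (EdgeOf w u v)
edgeOf? w u v = any? λ i → traverses? w i u v

module _ {n : ℕ} (Γ : Graph n) where

  sameCycle-sym : ∀ {l} {c c' : Fin l → Fin n} → SameCycle Γ c c' → SameCycle Γ c' c
  sameCycle-sym s x y = swap (s x y)

  sameCycle-trans : ∀ {l} {c c' c'' : Fin l → Fin n} →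
                    SameCycle Γ c c' → SameCycle Γ c' c'' → SameCycle Γ c c''
  sameCycle-trans s t x y = proj₁ (t x y) ∘ proj₁ (s x y) , proj₂ (s x y) ∘ proj₂ (t x y)

  sameCycle-isEquivalence : ∀ {l} → IsEquivalence (SameCycle Γ {l})
  sameCycle-isEquivalence = record { refl = λ x y → id , id ; sym = sameCycle-sym ; trans = sameCycle-trans }

  sameCycle? : ∀ {l} → Decidable (SameCycle Γ {l})
  sameCycle? c c' = all? λ x → all? λ y →
    (edgeOf? c x y →-dec edgeOf? c' x y) ×-dec (edgeOf? c' x y →-dec edgeOf? c x y)

  sameCycle-decSetoid : ℕ → DecSetoid 0ℓ 0ℓ
  sameCycle-decSetoid l = record
    { Carrier = Fin l → Fin n
    ; _≈_ = SameCycle Γ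
    ; isDecEquivalence = record { isEquivalence = sameCycle-isEquivalence ; _≟_ = sameCycle? }
    }

  sameCycle-edgeOf : ∀ {l} {c c' : Fin l → Fin n} {u v} → SameCycle Γ c c' → EdgeOf c u v → EdgeOf c' u v
  sameCycle-edgeOf s = proj₁ (s _ _)

  ≗⇒sameCycle : ∀ {l} {c c' : Fin l → Fin n} → c ≗ c' → SameCycle Γ c c'
  ≗⇒sameCycle c≗c' x y = edgeOf-≗ c≗c' , edgeOf-≗ (sym ∘ c≗c')

  sameCycle-map : ∀ {l} {c c' : Fin l → Fin n} (σ : Fin n ↔ Fin n) →
                  SameCycle Γ c c' → SameCycle Γ (Inverse.to σ ∘ c) (Inverse.to σ ∘ c')
  sameCycle-map σ s x y = transport s , transport (sameCycle-sym s)
    where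
    open Inverse σ using (to; from; strictlyInverseˡ; strictlyInverseʳ)
    transport : ∀ {w w'} → SameCycle Γ w w' → EdgeOf (to ∘ w) x y → EdgeOf (to ∘ w') x y
    transport s e = subst₂ (EdgeOf _) (strictlyInverseˡ x) (strictlyInverseˡ y)
      (edgeOf-map to (sameCycle-edgeOf s (edgeOf-≗ (strictlyInverseʳ ∘ _) (edgeOf-map from e))))

  graphAut-inverse : ∀ σ → IsGraphAut Γ σ → IsGraphAut Γ (↔-sym σ)
  graphAut-inverse σ σ-aut u v = trans (sym (σ-aut _ _))
    (cong₂ (Graph.adj Γ) (Inverse.strictlyInverseˡ σ u) (Inverse.strictlyInverseˡ σ v))

  graphAut-cycle : ∀ σ {k c} → IsGraphAut Γ σ → IsCycle Γ k c → IsCycle Γ k (Inverse.to σ ∘ c)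
  graphAut-cycle σ {c = c} σ-aut (3≤k , c-injective , c-adj) =
    3≤k , (λ i j eq → c-injective i j (Injection.injective (↔⇒↣ σ) eq)) ,
    (λ i → trans (σ-aut (c i) (c (cnext i))) (c-adj i))

module _ {n : ℕ} (Γ : Graph n) {m : ℕ} {c : Fin (3 + m) → Fin n} (c-cycle : IsCycle Γ (3 + m) c) where

  traversals-count : ∀ u v → ∑[ i < 3 + m ] 𝟙 (does (traverses? c i u v)) ≡ 𝟙 (does (edgeOf? c u v))
  traversals-count u v = count (edgeOf? c u v)
    where
    count : (e? : Dec (EdgeOf c u v)) → ∑[ i < 3 + m ] 𝟙 (does (traverses? c i u v)) ≡ 𝟙 (does e?)
    count (yes (j , t)) = trans (∑-support₁ _ j elsewhere) (cong 𝟙 (dec-true (traverses? c j u v) t))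
      where
      elsewhere : ∀ i → i ≢ j → 𝟙 (does (traverses? c i u v)) ≡ 0
      elsewhere i i≢j =
        cong 𝟙 (dec-false (traverses? c i u v) (λ t' → i≢j (traverses-unique Γ c-cycle t' t)))
    count (no ¬e) = ∑-zero (λ i → cong 𝟙 (dec-false (traverses? c i u v) (λ t → ¬e (i , t))))

  -- SameClosedWalk is declared relative to a map, but does not depend on it.
  sameCycle⇒sameClosedWalk : ∀ (M : Map Γ) {c' : Fin (3 + m) → Fin n} → IsCycle Γ (3 + m) c' →
                             SameCycle Γ c c' → SameClosedWalk M c c'
  sameCycle⇒sameClosedWalk M {c'} c'-cycle same = h↔ , h-correct , orientation
    where
    c-injective : ∀ {i j} → c i ≡ c j → i ≡ j
    c-injective = cycle-injective Γ c-cycle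
    c'-injective : ∀ {i j} → c' i ≡ c' j → i ≡ j
    c'-injective = cycle-injective Γ c'-cycle

    step : ∀ i → EdgeOf c' (c i) (c (cnext i))
    step i = sameCycle-edgeOf Γ same (i , inj₁ (refl , refl))
    h : Fin (3 + m) → Fin (3 + m)
    h i = proj₁ (edgeOf-position (step i))
    h-correct : ∀ i → c' (h i) ≡ c i
    h-correct i = proj₂ (edgeOf-position (step i))
    step⁻¹ : ∀ j → EdgeOf c (c' j) (c' (cnext j))
    step⁻¹ j = sameCycle-edgeOf Γ (sameCycle-sym Γ same) (j , inj₁ (refl , refl))
    h⁻¹ : Fin (3 + m) → Fin (3 + m)
    h⁻¹ j = proj₁ (edgeOf-position (step⁻¹ j))
    h⁻¹-correct : ∀ j → c (h⁻¹ j) ≡ c' j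
    h⁻¹-correct j = proj₂ (edgeOf-position (step⁻¹ j))
    h↔ : Fin (3 + m) ↔ Fin (3 + m)
    h↔ = mk↔ₛ′ h h⁻¹ (λ j → c'-injective (trans (h-correct (h⁻¹ j)) (h⁻¹-correct j)))
                     (λ i → c-injective (trans (h⁻¹-correct (h i)) (h-correct i)))
    h-injective : ∀ {i j} → h i ≡ h j → i ≡ j
    h-injective {i} {j} eq = c-injective (trans (sym (h-correct i)) (trans (cong c' eq) (h-correct j)))

    Forward Backward : Fin (3 + m) → Set
    Forward i = h (cnext i) ≡ cnext (h i)
    Backward i = cnext (h (cnext i)) ≡ h i

    local : ∀ i → Forward i ⊎ Backward i
    local i = edgeOf-consecutive Γ c'-cycle
      (subst₂ (EdgeOf c') (sym (h-correct i)) (sym (h-correct (cnext i))) (step i))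

    forward-step : ∀ i → Forward i → Forward (cnext i)
    forward-step i fwd with local (cnext i)
    ... | inj₁ fwd' = fwd'
    ... | inj₂ bwd' = contradiction (h-injective (cnext-injective (trans bwd' fwd))) (cnext²≢id i)

    backward-step : ∀ i → Backward i → Backward (cnext i)
    backward-step i bwd with local (cnext i)
    ... | inj₁ fwd' = contradiction (h-injective (trans fwd' bwd)) (cnext²≢id i)
    ... | inj₂ bwd' = bwd'

    orientation : (∀ i → Forward i) ⊎ (∀ i → Backward i)
    orientation with local zero
    ... | inj₁ fwd = inj₁ (cnext-induction Forward fwd forward-step)
    ... | inj₂ bwd = inj₂ (cnext-induction Backward bwd backward-step)

stepIs≡traverses? : ∀ {n} {Γ : Graph n} (M : Map Γ) f i u v →
                    stepIs M f i u v ≡ does (traverses? (Map.walk M f) i u v)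
stepIs≡traverses? M f i u v =
  cong₂ _∨_ (cong₂ _∧_ (isYes≗does (w i ≟ u)) (isYes≗does (w (cnext i) ≟ v)))
            (cong₂ _∧_ (isYes≗does (w i ≟ v)) (isYes≗does (w (cnext i) ≟ u)))
  where w = Map.walk M f

stepIs-sound : ∀ {n} {Γ : Graph n} (M : Map Γ) f i u v →
               stepIs M f i u v ≡ true → Traverses (Map.walk M f) i u v
stepIs-sound M f i u v step = decidable-stable (traverses? (Map.walk M f) i u v) λ ¬t →
  contradiction (trans (sym step) (trans (stepIs≡traverses? M f i u v) (dec-false (traverses? (Map.walk M f) i u v) ¬t)))
                λ ()

-- Girth-regular graphs of signature (2,2,2)

-- Opaque, so that these decision procedures are never unfolded during conversion checking.
opaque
  fin2-pigeonhole : ∀ (k₁ k₂ k₃ : Fin 2) → k₁ ≡ k₂ ⊎ k₁ ≡ k₃ ⊎ k₂ ≡ k₃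
  fin2-pigeonhole = from-yes (all? λ (k₁ : Fin 2) → all? λ (k₂ : Fin 2) → all? λ (k₃ : Fin 2) →
    (k₁ ≟ k₂) ⊎-dec (k₁ ≟ k₃) ⊎-dec (k₂ ≟ k₃))

  fin3-third : ∀ (a b : Fin 3) → ∃ λ d → d ≢ a × d ≢ b
  fin3-third = from-yes (all? λ (a : Fin 3) → all? λ (b : Fin 3) → any? λ (d : Fin 3) →
    ¬? (d ≟ a) ×-dec ¬? (d ≟ b))

  fin3-cover : ∀ {a b d : Fin 3} → a ≢ b → d ≢ a → d ≢ b → ∀ x → x ≡ a ⊎ x ≡ b ⊎ x ≡ d
  fin3-cover {a} {b} {d} = from-yes (all? λ (a′ : Fin 3) → all? λ (b′ : Fin 3) → all? λ (d′ : Fin 3) →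
    ¬? (a′ ≟ b′) →-dec ¬? (d′ ≟ a′) →-dec ¬? (d′ ≟ b′) →-dec all? λ (x : Fin 3) →
    (x ≟ a′) ⊎-dec (x ≟ b′) ⊎-dec (x ≟ d′)) a b d

module Signature222 {n : ℕ} (Γ : Graph n) {m : ℕ}
                    (girth-regular : GirthRegularWithSignature Γ (3 + m) (2 ∷ 2 ∷ 2 ∷ [])) where

  Walk : Set
  Walk = Fin (3 + m) → Fin n

  GirthCycle : Walk → Set
  GirthCycle = IsCycle Γ (3 + m)

  private
    infix 4 _≋_
    _≋_ : Walk → Walk → Set
    _≋_ = SameCycle Γ
    ≋-sym : ∀ {c c'} → c ≋ c' → c' ≋ c
    ≋-sym = sameCycle-sym Γ
    ≋-trans : ∀ {c c' c''} → c ≋ c' → c' ≋ c'' → c ≋ c''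
    ≋-trans = sameCycle-trans Γ

  neighbour : Fin n → Fin 3 → Fin n
  neighbour v = proj₁ (girth-regular v)

  neighbour-injective : ∀ v {a b} → neighbour v a ≡ neighbour v b → a ≡ b
  neighbour-injective v = proj₁ (proj₂ (girth-regular v)) _ _

  neighbour-onto : ∀ v {u} → Adj Γ v u → ∃ λ a → neighbour v a ≡ u
  neighbour-onto v = proj₁ (proj₂ (proj₂ (proj₂ (girth-regular v)))) _

  -- lookup (2 ∷ 2 ∷ 2 ∷ []) a only computes for a concrete index a.
  ε≡2 : ∀ v a → Eps Γ (3 + m) v (neighbour v a) 2
  ε≡2 v zero             = proj₁ (proj₂ (proj₂ (proj₂ (proj₂ (girth-regular v))))) zero
  ε≡2 v (suc zero)       = proj₁ (proj₂ (proj₂ (proj₂ (proj₂ (girth-regular v))))) (suc zero)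
  ε≡2 v (suc (suc zero)) = proj₁ (proj₂ (proj₂ (proj₂ (proj₂ (girth-regular v))))) (suc (suc zero))

  Uses : Fin n → Walk → Fin 3 → Set
  Uses v c a = EdgeOf c v (neighbour v a)

  Misses : Fin n → Walk → Fin 3 → Set
  Misses v c d = ¬ Uses v c d × (∀ a → a ≢ d → Uses v c a)

  edgeCycle : ∀ v a → Fin 2 → Walk
  edgeCycle v a = proj₁ (ε≡2 v a)

  edgeCycle-girth : ∀ v a k → GirthCycle (edgeCycle v a k)
  edgeCycle-girth v a k = proj₁ (proj₁ (proj₂ (ε≡2 v a)) k)

  edgeCycle-uses : ∀ v a k → Uses v (edgeCycle v a k) a
  edgeCycle-uses v a k = proj₂ (proj₁ (proj₂ (ε≡2 v a)) k)

  edgeCycle-distinct : ∀ v a → ¬ edgeCycle v a zero ≋ edgeCycle v a (suc zero)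
  edgeCycle-distinct v a same with () ← proj₁ (proj₂ (proj₂ (ε≡2 v a))) zero (suc zero) same

  edgeCycle-complete : ∀ v a {c} → GirthCycle c → Uses v c a → ∃ λ k → c ≋ edgeCycle v a k
  edgeCycle-complete v a = proj₂ (proj₂ (proj₂ (ε≡2 v a))) _

  at-most-two-through-edge : ∀ v a {c₁ c₂ c₃} → GirthCycle c₁ → GirthCycle c₂ → GirthCycle c₃ →
                             Uses v c₁ a → Uses v c₂ a → Uses v c₃ a → c₁ ≋ c₂ ⊎ c₁ ≋ c₃ ⊎ c₂ ≋ c₃
  at-most-two-through-edge v a γ₁ γ₂ γ₃ u₁ u₂ u₃
    with k₁ , c₁≋ ← edgeCycle-complete v a γ₁ u₁
       | k₂ , c₂≋ ← edgeCycle-complete v a γ₂ u₂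
       | k₃ , c₃≋ ← edgeCycle-complete v a γ₃ u₃
    with fin2-pigeonhole k₁ k₂ k₃
  ... | inj₁ refl        = inj₁ (≋-trans c₁≋ (≋-sym c₂≋))
  ... | inj₂ (inj₁ refl) = inj₂ (inj₁ (≋-trans c₁≋ (≋-sym c₃≋)))
  ... | inj₂ (inj₂ refl) = inj₂ (inj₂ (≋-trans c₂≋ (≋-sym c₃≋)))

  misses-≋ : ∀ {v c c' d} → c ≋ c' → Misses v c d → Misses v c' d
  misses-≋ c≋c' (¬uses , uses) =
    ¬uses ∘ sameCycle-edgeOf Γ (≋-sym c≋c') , sameCycle-edgeOf Γ c≋c' ∘₂ uses

  misses-unique : ∀ {v c d d'} → Misses v c d → Misses v c d' → d ≡ d'
  misses-unique {d = d} {d'} (¬uses , _) (_ , uses') with d ≟ d'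
  ... | yes d≡d' = d≡d'
  ... | no d≢d'  = contradiction (uses' d d≢d') ¬uses

  -- Opaque: only the types of these lemmas matter, and unfolding them makes checking explode.
  opaque
    misses-some : ∀ {c} → GirthCycle c → ∀ j → ∃ (Misses (c j) c)
    misses-some {c} γ j = d , ¬uses-d , uses-others
      where
      v : Fin n
      v = c j
      c-adj : ∀ i → Adj Γ (c i) (c (cnext i))
      c-adj = proj₂ (proj₂ γ)
      next : ∃ λ α → neighbour v α ≡ c (cnext j)
      next = neighbour-onto v (c-adj j)
      prev : ∃ λ β → neighbour v β ≡ c (cprev j)
      prev = neighbour-onto v
        (trans (Graph.sym Γ v _) (subst (Adj Γ (c (cprev j)) ∘ c) (cnext-cprev j) (c-adj (cprev j))))
      α β : Fin 3
      α = proj₁ next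
      β = proj₁ prev
      α≢β : α ≢ β
      α≢β α≡β = neighbours-distinct Γ γ j
        (trans (sym (proj₂ next)) (trans (cong (neighbour v) α≡β) (proj₂ prev)))
      third : ∃ λ d → d ≢ α × d ≢ β
      third = fin3-third α β
      d : Fin 3
      d = proj₁ third
      d≢α : d ≢ α
      d≢α = proj₁ (proj₂ third)
      d≢β : d ≢ β
      d≢β = proj₂ (proj₂ third)
      ¬uses-d : ¬ Uses v c d
      ¬uses-d uses with edgeOf-neighbour Γ γ uses
      ... | inj₁ eq = d≢α (neighbour-injective v (trans eq (sym (proj₂ next))))
      ... | inj₂ eq = d≢β (neighbour-injective v (trans eq (sym (proj₂ prev))))
      uses-others : ∀ a → a ≢ d → Uses v c a
      uses-others a a≢d with fin3-cover α≢β d≢α d≢β a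
      ... | inj₁ refl        = j , inj₁ (refl , sym (proj₂ next))
      ... | inj₂ (inj₁ refl) = cprev j , inj₂ (sym (proj₂ prev) , cong c (cnext-cprev j))
      ... | inj₂ (inj₂ a≡d)  = contradiction a≡d a≢d

    misses-≢-used : ∀ {v c d a} → Misses v c d → Uses v c a → d ≢ a
    misses-≢-used (¬uses , _) uses refl = ¬uses uses

    misses-at : ∀ {v c x} → GirthCycle c → EdgeOf c v x → ∃ (Misses v c)
    misses-at γ e with j , refl ← edgeOf-position e = misses-some γ j

    misses-determines : ∀ {v c c' d} → GirthCycle c → GirthCycle c' →
                        Misses v c d → Misses v c' d → c ≋ c'
    misses-determines {v} {d = d} γ γ' (¬uses , uses) (¬uses' , uses')
      with d' , ¬uses-d' , uses-D ← misses-at (edgeCycle-girth v d zero) (edgeCycle-uses v d zero)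
      with e , e≢d , e≢d' ← fin3-third d d'
      with at-most-two-through-edge v e γ γ' (edgeCycle-girth v d zero)
             (uses e e≢d) (uses' e e≢d) (uses-D e e≢d')
    ... | inj₁ c≋c'        = c≋c'
    ... | inj₂ (inj₁ c≋D)  = contradiction (sameCycle-edgeOf Γ (≋-sym c≋D) (edgeCycle-uses v d zero)) ¬uses
    ... | inj₂ (inj₂ c'≋D) = contradiction (sameCycle-edgeOf Γ (≋-sym c'≋D) (edgeCycle-uses v d zero)) ¬uses'

    misses-exists : ∀ v d → ∃ λ c → GirthCycle c × Misses v c d
    misses-exists v d
      with a , a≢d , _ ← fin3-third d d
      with d₀ , misses₀ ← misses-at (edgeCycle-girth v a zero) (edgeCycle-uses v a zero)
         | d₁ , misses₁ ← misses-at (edgeCycle-girth v a (suc zero)) (edgeCycle-uses v a (suc zero))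
      with d₀ ≟ d | d₁ ≟ d
    ... | yes refl | _        = edgeCycle v a zero , edgeCycle-girth v a zero , misses₀
    ... | no _     | yes refl = edgeCycle v a (suc zero) , edgeCycle-girth v a (suc zero) , misses₁
    ... | no d₀≢d  | no d₁≢d
      with fin3-cover a≢d (misses-≢-used misses₀ (edgeCycle-uses v a zero)) d₀≢d d₁
    ...   | inj₁ d₁≡a        = contradiction d₁≡a (misses-≢-used misses₁ (edgeCycle-uses v a (suc zero)))
    ...   | inj₂ (inj₁ d₁≡d) = contradiction d₁≡d d₁≢d
    ...   | inj₂ (inj₂ refl) = contradiction
            (misses-determines (edgeCycle-girth v a zero) (edgeCycle-girth v a (suc zero)) misses₀ misses₁)
            (edgeCycle-distinct v a)

  cornerCycle : Fin n → Fin 3 → Walk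
  cornerCycle v d = proj₁ (misses-exists v d)

  cornerCycle-girth : ∀ v d → GirthCycle (cornerCycle v d)
  cornerCycle-girth v d = proj₁ (proj₂ (misses-exists v d))

  cornerCycle-misses : ∀ v d → Misses v (cornerCycle v d) d
  cornerCycle-misses v d = proj₂ (proj₂ (misses-exists v d))

  girthCycle-≋-corner : ∀ {c} → GirthCycle c → ∃₂ λ v d → c ≋ cornerCycle v d
  girthCycle-≋-corner {c} γ with d , misses ← misses-some γ zero =
    c zero , d , misses-determines γ (cornerCycle-girth (c zero) d) misses (cornerCycle-misses (c zero) d)

  corners : Fin (n * 3) → Walk
  corners = uncurry cornerCycle ∘ Inverse.to *↔×

  private
    faceTransversal : Transversal (sameCycle-decSetoid Γ (3 + m)) corners
    faceTransversal = transversal _ corners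
    open Transversal faceTransversal using (rep; rep-apart; rep-cover)

  faceCount : ℕ
  faceCount = Transversal.size faceTransversal

  face : Fin faceCount → Walk
  face = corners ∘ rep

  face-girth : ∀ f → GirthCycle (face f)
  face-girth f = uncurry cornerCycle-girth (Inverse.to *↔× (rep f))

  face-unique : ∀ {f f'} → face f ≋ face f' → f ≡ f'
  face-unique = rep-apart

  cornerCycle-face : ∀ v d → ∃ λ f → face f ≋ cornerCycle v d
  cornerCycle-face v d = f , subst (face f ≋_) corner-index face≋
    where
    i : Fin (n * 3)
    i = Inverse.from *↔× (v , d)
    f : Fin faceCount
    f = proj₁ (rep-cover i)
    face≋ : face f ≋ corners i
    face≋ = proj₂ (rep-cover i)
    corner-index : corners i ≡ cornerCycle v d
    corner-index = cong (uncurry cornerCycle) (Inverse.strictlyInverseˡ *↔× (v , d))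

  girthCycle-face : ∀ {c} → GirthCycle c → ∃ λ f → face f ≋ c
  girthCycle-face γ =
    let v , d , c≋corner = girthCycle-≋-corner γ
        f , f≋corner = cornerCycle-face v d
    in f , ≋-trans f≋corner (≋-sym c≋corner)

  faceMap : Map Γ
  faceMap = record { F = faceCount ; len = λ _ → 3 + m ; walk = face }

  faces-through-edge : ∀ {u v} → Adj Γ u v → ∃₂ λ f₀ f₁ → f₀ ≢ f₁ ×
    EdgeOf (face f₀) u v × EdgeOf (face f₁) u v × (∀ f → f ≢ f₀ → f ≢ f₁ → ¬ EdgeOf (face f) u v)
  faces-through-edge {u} uv with a , refl ← neighbour-onto u uv =
    faceThrough zero , faceThrough (suc zero) , apart , uses zero , uses (suc zero) , only
    where
    faceThrough : Fin 2 → Fin faceCount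
    faceThrough k = proj₁ (girthCycle-face (edgeCycle-girth u a k))
    faceThrough-≋ : ∀ k → face (faceThrough k) ≋ edgeCycle u a k
    faceThrough-≋ k = proj₂ (girthCycle-face (edgeCycle-girth u a k))
    apart : faceThrough zero ≢ faceThrough (suc zero)
    apart eq = edgeCycle-distinct u a
      (≋-trans (≋-sym (faceThrough-≋ zero))
               (subst (λ f → face f ≋ edgeCycle u a (suc zero)) (sym eq) (faceThrough-≋ (suc zero))))
    uses : ∀ k → Uses u (face (faceThrough k)) a
    uses k = sameCycle-edgeOf Γ (≋-sym (faceThrough-≋ k)) (edgeCycle-uses u a k)
    only : ∀ f → f ≢ faceThrough zero → f ≢ faceThrough (suc zero) → ¬ Uses u (face f) a
    only f f≢f₀ f≢f₁ e with edgeCycle-complete u a (face-girth f) e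
    ... | zero     , f≋ = f≢f₀ (face-unique (≋-trans f≋ (≋-sym (faceThrough-≋ zero))))
    ... | suc zero , f≋ = f≢f₁ (face-unique (≋-trans f≋ (≋-sym (faceThrough-≋ (suc zero)))))

  sidesOf≡2 : ∀ u v → Adj Γ u v → sidesOf faceMap u v ≡ 2
  sidesOf≡2 u v uv with f₀ , f₁ , f₀≢f₁ , e₀ , e₁ , only ← faces-through-edge uv = begin
    sidesOf faceMap u v
      ≡⟨ sum-map-allFin (λ f → ∣ tabulate (λ i → stepIs faceMap f i u v) ∣) ⟩
    ∑[ f < faceCount ] ∣ tabulate (λ i → stepIs faceMap f i u v) ∣
      ≡⟨ sum-cong-≗ {faceCount} (λ f → begin
           ∣ tabulate (λ i → stepIs faceMap f i u v) ∣
             ≡⟨ ∣tabulate∣≡∑𝟙 (λ i → stepIs faceMap f i u v) ⟩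
           ∑[ i < 3 + m ] 𝟙 (stepIs faceMap f i u v)
             ≡⟨ sum-cong-≗ {3 + m} (λ i → cong 𝟙 (stepIs≡traverses? faceMap f i u v)) ⟩
           ∑[ i < 3 + m ] 𝟙 (does (traverses? (face f) i u v))
             ≡⟨ traversals-count Γ (face-girth f) u v ⟩
           𝟙 (does (edgeOf? (face f) u v)) ∎) ⟩
    ∑[ f < faceCount ] 𝟙 (does (edgeOf? (face f) u v))
      ≡⟨ ∑-support₂ (λ f → 𝟙 (does (edgeOf? (face f) u v))) f₀≢f₁
           (λ f f≢f₀ f≢f₁ → cong 𝟙 (dec-false (edgeOf? (face f) u v) (only f f≢f₀ f≢f₁))) ⟩
    𝟙 (does (edgeOf? (face f₀) u v)) + 𝟙 (does (edgeOf? (face f₁) u v))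
      ≡⟨ cong₂ (λ x y → 𝟙 x + 𝟙 y) (dec-true (edgeOf? (face f₀) u v) e₀)
                                   (dec-true (edgeOf? (face f₁) u v) e₁) ⟩
    2 ∎
    where open ≡-Reasoning

  corner-link : ∀ {v a b} → Adj Γ v a → Adj Γ v b → a ≢ b → LinkAdj faceMap v a b
  corner-link {v} va vb a≢b
    with α , refl ← neighbour-onto v va | β , refl ← neighbour-onto v vb
    with d , d≢α , d≢β ← fin3-third α β
    with f , f≋ ← girthCycle-face (cornerCycle-girth v d)
    with _ , uses ← misses-≋ (≋-sym f≋) (cornerCycle-misses v d)
    with edgeOf-passesThrough Γ (face-girth f) a≢b (uses α (d≢α ∘ sym)) (uses β (d≢β ∘ sym))
  ... | inj₁ passes = inj₁ (f , passes)
  ... | inj₂ passes = inj₂ (f , passes)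

  link-connected : ∀ v a b → Adj Γ v a → Adj Γ v b → Star (LinkAdj faceMap v) a b
  link-connected v a b va vb with a ≟ b
  ... | yes refl = ε
  ... | no a≢b   = corner-link va vb a≢b ◅ ε

  faceMap-isMap : IsMap faceMap
  faceMap-isMap =
    (λ _ → s≤s z≤n) , (λ f → proj₂ (proj₂ (face-girth f))) , simple , sidesOf≡2 , link-connected
    where
    simple : ∀ f i j → i ≢ j → ¬ (stepIs faceMap f j (face f i) (face f (cnext i)) ≡ true)
    simple f i j i≢j step = i≢j (traverses-unique Γ (face-girth f) (inj₁ (refl , refl))
      (stepIs-sound faceMap f j (face f i) (face f (cnext i)) step))

  flag→corner : Fin faceCount × Fin (3 + m) → Fin n × Fin 3
  flag→corner (f , i) = face f i , proj₁ (misses-some (face-girth f) i)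

  flag→corner-injective : Injective _≡_ _≡_ flag→corner
  flag→corner-injective {f , i} {f' , i'} eq = cong₂ _,_ f≡f' i≡i'
    where
    v≡v' : face f i ≡ face f' i'
    v≡v' = cong proj₁ eq
    misses : Misses (face f i) (face f) (proj₁ (misses-some (face-girth f) i))
    misses = proj₂ (misses-some (face-girth f) i)
    misses' : Misses (face f i) (face f') (proj₁ (misses-some (face-girth f) i))
    misses' = subst₂ (λ v d → Misses v (face f') d) (sym v≡v') (sym (cong proj₂ eq))
                     (proj₂ (misses-some (face-girth f') i'))
    f≡f' : f ≡ f'
    f≡f' = face-unique (misses-determines (face-girth f) (face-girth f') misses misses')
    i≡i' : i ≡ i'
    i≡i' = cycle-injective Γ (face-girth f') (trans (cong (λ f → face f i) (sym f≡f')) v≡v')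

  corner-flag : ∀ v d → Σ (Fin faceCount) λ f → Σ (Fin (3 + m)) λ j → face f j ≡ v × Misses v (face f) d
  corner-flag v d
    with f , f≋ ← girthCycle-face (cornerCycle-girth v d)
    with misses ← misses-≋ (≋-sym f≋) (cornerCycle-misses v d)
    with a , a≢d , _ ← fin3-third d d
    with j , fj≡v ← edgeOf-position (proj₂ misses a a≢d)
    = f , j , fj≡v , misses

  corner→flag : Fin n × Fin 3 → Fin faceCount × Fin (3 + m)
  corner→flag (v , d) = proj₁ (corner-flag v d) , proj₁ (proj₂ (corner-flag v d))

  corner→flag-injective : Injective _≡_ _≡_ corner→flag
  corner→flag-injective {v , d} {v' , d'} eq = cong₂ _,_ v≡v' d≡d'
    where
    f = proj₁ (corner-flag v d)
    f' = proj₁ (corner-flag v' d')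
    f≡f' : f ≡ f'
    f≡f' = cong proj₁ eq
    v≡v' : v ≡ v'
    v≡v' = trans (sym (proj₁ (proj₂ (proj₂ (corner-flag v d)))))
                 (trans (cong₂ face f≡f' (cong proj₂ eq)) (proj₁ (proj₂ (proj₂ (corner-flag v' d')))))
    misses' : Misses v (face f) d'
    misses' = subst₂ (λ v f → Misses v (face f) d') (sym v≡v') (sym f≡f')
                     (proj₂ (proj₂ (proj₂ (corner-flag v' d'))))
    d≡d' : d ≡ d'
    d≡d' = misses-unique (proj₂ (proj₂ (proj₂ (corner-flag v d)))) misses'

  faceCount*g≡n*3 : faceCount * (3 + m) ≡ n * 3
  faceCount*g≡n*3 = cantor-schröder-bernstein-× (mk↣ flag→corner-injective) (mk↣ corner→flag-injective)

  module _ (σ : Fin n ↔ Fin n) (σ-aut : IsGraphAut Γ σ) where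

    facePerm : Fin faceCount → Fin faceCount
    facePerm f = proj₁ (girthCycle-face (graphAut-cycle Γ σ σ-aut (face-girth f)))

    facePerm-≋ : ∀ f → face (facePerm f) ≋ Inverse.to σ ∘ face f
    facePerm-≋ f = proj₂ (girthCycle-face (graphAut-cycle Γ σ σ-aut (face-girth f)))

  facePerm-inverse : ∀ σ τ (σ-aut : IsGraphAut Γ σ) (τ-aut : IsGraphAut Γ τ) →
                     (∀ x → Inverse.to τ (Inverse.to σ x) ≡ x) →
                     ∀ f → facePerm τ τ-aut (facePerm σ σ-aut f) ≡ f
  facePerm-inverse σ τ σ-aut τ-aut τσ≡id f = face-unique
    (≋-trans (facePerm-≋ τ τ-aut (facePerm σ σ-aut f))
    (≋-trans (sameCycle-map Γ τ (facePerm-≋ σ σ-aut f))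
             (≗⇒sameCycle Γ (τσ≡id ∘ face f))))

  faceMap-extends : ∀ σ → IsGraphAut Γ σ → ExtendsToMapAut faceMap σ
  faceMap-extends σ σ-aut = σ-aut , π , λ f →
    sameCycle⇒sameClosedWalk Γ (graphAut-cycle Γ σ σ-aut (face-girth f)) faceMap
      (face-girth (facePerm σ σ-aut f)) (≋-sym (facePerm-≋ σ σ-aut f))
    where
    σ⁻¹-aut : IsGraphAut Γ (↔-sym σ)
    σ⁻¹-aut = graphAut-inverse Γ σ σ-aut
    π : Fin faceCount ↔ Fin faceCount
    π = mk↔ₛ′ (facePerm σ σ-aut) (facePerm (↔-sym σ) σ⁻¹-aut)
          (facePerm-inverse (↔-sym σ) σ σ⁻¹-aut σ-aut (Inverse.strictlyInverseˡ σ))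
          (facePerm-inverse σ (↔-sym σ) σ-aut σ⁻¹-aut (Inverse.strictlyInverseʳ σ))

  faceMap-vertexTransitive : VertexTransitive Γ → MapVertexTransitive faceMap
  faceMap-vertexTransitive vt u v with σ , σ-aut , σu≡v ← vt u v = σ , faceMap-extends σ σ-aut , σu≡v

-- Euler characteristic

eulerChar-identity : ∀ {n g E F : ℕ} → E + E ≡ n * 3 → F * g ≡ n * 3 →
                     + (2 * g) ℤ.* ((+ n ℤ.- + E) ℤ.+ + F) ≡ + (6 * n) ℤ.- + (g * n)
eulerChar-identity {n} {g} {E} {F} 2E≡3n Fg≡3n = begin
  + (2 * g) ℤ.* ((+ n ℤ.- + E) ℤ.+ + F)
    ≡⟨ cong (ℤ._* _) (pos-* 2 g) ⟩
  (+ 2 ℤ.* + g) ℤ.* ((+ n ℤ.- + E) ℤ.+ + F)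
    ≡⟨ expand (+ g) (+ n) (+ E) (+ F) ⟩
  (+ 2 ℤ.* + g) ℤ.* + n ℤ.- + g ℤ.* (+ E ℤ.+ + E) ℤ.+ + 2 ℤ.* (+ F ℤ.* + g)
    ≡⟨ cong₂ (λ x y → (+ 2 ℤ.* + g) ℤ.* + n ℤ.- + g ℤ.* x ℤ.+ + 2 ℤ.* y)
             (in-ℤ 2E≡3n (pos-+ E E)) (in-ℤ Fg≡3n (pos-* F g)) ⟩
  (+ 2 ℤ.* + g) ℤ.* + n ℤ.- + g ℤ.* (+ n ℤ.* + 3) ℤ.+ + 2 ℤ.* (+ n ℤ.* + 3)
    ≡⟨ collect (+ g) (+ n) ⟩
  + 6 ℤ.* + n ℤ.- + g ℤ.* + n
    ≡⟨ cong₂ ℤ._-_ (pos-* 6 n) (pos-* g n) ⟨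
  + (6 * n) ℤ.- + (g * n)
    ∎
  where
  open ≡-Reasoning
  expand : ∀ g n E F →
           (+ 2 ℤ.* g) ℤ.* ((n ℤ.- E) ℤ.+ F) ≡ (+ 2 ℤ.* g) ℤ.* n ℤ.- g ℤ.* (E ℤ.+ E) ℤ.+ + 2 ℤ.* (F ℤ.* g)
  expand = solve-∀
  collect : ∀ g n →
            (+ 2 ℤ.* g) ℤ.* n ℤ.- g ℤ.* (n ℤ.* + 3) ℤ.+ + 2 ℤ.* (n ℤ.* + 3) ≡ + 6 ℤ.* n ℤ.- g ℤ.* n
  collect = solve-∀
  in-ℤ : ∀ {a x} → a ≡ n * 3 → + a ≡ x → x ≡ + n ℤ.* + 3
  in-ℤ a≡3n +a≡x = trans (sym +a≡x) (trans (cong +_ a≡3n) (pos-* n 3))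

theorem3p11 : ∀ {n g : ℕ} (Γ : Graph n) →
    Connected Γ → Cubic Γ → HasGirth Γ g →
    GirthRegularWithSignature Γ g (2 ∷ 2 ∷ 2 ∷ []) →
    (g ∣ 3 * n) ×
    Σ (Map Γ) (λ M →
    IsMKMap M g 3 ×
    (+ (2 * g) ℤ.* eulerChar M ≡ + (6 * n) ℤ.- + (g * n)) ×
    (∀ σ → IsGraphAut Γ σ → ExtendsToMapAut M σ) ×
    (VertexTransitive Γ → MapVertexTransitive M))
theorem3p11 {n} Γ _ cubic ((_ , 3≤g , _) , _) girth-regular with m , refl ← m≤n⇒∃[o]m+o≡n 3≤g =
  divides faceCount (trans (*-comm 3 n) (sym faceCount*g≡n*3)) ,
  faceMap ,
  (faceMap-isMap , cubic , λ _ → refl) ,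
  eulerChar-identity {n} {3 + m} {edgeCount Γ} {faceCount} 2E≡3n faceCount*g≡n*3 ,
  faceMap-extends ,
  faceMap-vertexTransitive
  where
  open Signature222 Γ girth-regular
  2E≡3n : edgeCount Γ + edgeCount Γ ≡ n * 3
  2E≡3n = trans (handshake Γ) (∑-const 3 cubic)
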